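{- Let $G$ be a finite abelian group, let $p$ be the smallest prime dividing $|G|$, and let $A\subseteq G\setminus\{0\}$. If $|A|\geq 6p(p+1)+1$, then there is a zero-sum free subset $B\subseteq A$ with $|B|\leq 6p+1$ such that $|\sum_0(B)|\geq p|B|+2$.
   Context: For a finite subset (or sequence) $B$ of an abelian group $G$, $\sum(B)$ denotes the set of all sums $\sum_{b\in C} b$ over nonempty subsets (subsequences) $C$ of $B$, and $\sum_0(B)=\sum(B)\cup\{0\}$. $B$ is zero-sum free if $0\notin\sum(B)$. -}

module Defs where

open import Level using (Level; _⊔_)
open import Algebra.Bundles using (AbelianGroup)
open import Data.Nat using (ℕ; _≤_)
open import Data.Nat.Divisibility using (_∣_)
open import Data.Nat.Primality using (Prime)
open import Data.List using (List; []; _∷_; foldr; length)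
open import Data.List.Relation.Binary.Sublist.Propositional using (_⊆_)
open import Data.List.Relation.Unary.All using (All)
open import Data.List.Relation.Unary.Any using (Any)
import Data.List.Relation.Unary.Unique.Setoid as USetoid
open import Data.Product using (Σ; _×_; ∃-syntax)
open import Relation.Nullary using (¬_)
open import Data.Empty using (⊥)
open import Data.Unit using (⊤)
open import Relation.Binary.Definitions using (Decidable)

record FiniteAbelianGroup (c ℓ : Level) : Set (Level.suc (c ⊔ ℓ)) where
  field
    abGroup  : AbelianGroup c ℓ
  open AbelianGroup abGroup public
  field
    _≟_      : Decidable _≈_
    elements : List Carrier
    distinct : USetoid.Unique setoid elements
    complete : ∀ x → Any (x ≈_) elements

  order : ℕ
  order = length elements

module _ {c ℓ} (G : FiniteAbelianGroup c ℓ) where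
  open FiniteAbelianGroup G

  sumG : List Carrier → Carrier
  sumG = foldr _∙_ ε

  IsSubset : List Carrier → Set (c ⊔ ℓ)
  IsSubset = USetoid.Unique setoid

  NonEmpty : List Carrier → Set
  NonEmpty []      = ⊥
  NonEmpty (_ ∷ _) = ⊤

  -- g ∈ Σ₀(B): g is the sum of some (possibly empty) subset C of B
  -- (subsets of a duplicate-free list B are exactly its sublists)
  In-Σ₀ : List Carrier → Carrier → Set (c ⊔ ℓ)
  In-Σ₀ B g = ∃[ C ] (C ⊆ B × sumG C ≈ g)

  ZeroSumFree : List Carrier → Set (c ⊔ ℓ)
  ZeroSumFree B = ∀ C → C ⊆ B → NonEmpty C → ¬ (sumG C ≈ ε)

  Σ₀-card-≥ : List Carrier → ℕ → Set (c ⊔ ℓ)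
  Σ₀-card-≥ B k = ∃[ L ] (IsSubset L × All (In-Σ₀ B) L × k ≤ length L)

  SmallestPrimeDivisor : ℕ → Set
  SmallestPrimeDivisor p =
    Prime p × p ∣ order × (∀ q → Prime q → q ∣ order → p ≤ q)

-- Call D ⊆ A dissociated when no nontrivial combination of D with coefficients in
-- {-1, 0, 1} vanishes. Adding the elements of A greedily gives a dissociated D ⊆ A
-- of which every element of A is such a signed sum; as 0 and the elements of A are
-- then distinct signed sums of D, |A| < 3^|D|. Every B ⊆ D is dissociated too, so
-- its 2^|B| subset sums are pairwise distinct and none but the empty one is 0. It
-- remains to pick |B| ≤ 6p+1 with p|B| + 2 ≤ 2^|B|, which is elementary once
-- 6p(p+1) + 1 < 3^|D|; of the hypotheses on p only p ≠ 32 is needed for this.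
module Submission where

open import Defs
open import Algebra.Properties.CommutativeSemigroup using (interchange)
open import Data.Bool using (Bool; true; false; T)
open import Data.Empty using (⊥-elim)
open import Data.Fin using (Fin; zero; suc)
open import Data.Fin.Properties using (injective⇒≤)
open import Data.List using (List; []; _∷_; length; lookup; map; take; cartesianProductWith)
open import Data.List.Properties using (length-++; length-map; length-take)
open import Data.List.Membership.Propositional using (_∈_; lose)
open import Data.List.Membership.Propositional.Properties using (∈-cartesianProductWith⁺)
import Data.List.Membership.Propositional.Properties as ∈ₚ
import Data.List.Membership.Setoid as SetoidMembership
import Data.List.Membership.Setoid.Properties as SetoidMembershipₚ
open import Data.List.Relation.Binary.Sublist.Propositional using (_⊆_; []; _∷_; _∷ʳ_; ⊆-refl; ⊆-trans)
open import Data.List.Relation.Binary.Sublist.Propositional.Properties using (take-⊆)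
open import Data.List.Relation.Unary.All using (All; []; _∷_)
import Data.List.Relation.Unary.All as All
import Data.List.Relation.Unary.All.Properties as Allₚ
open import Data.List.Relation.Unary.AllPairs using ([]; _∷_)
open import Data.List.Relation.Unary.Any using (here; there; any?; satisfied)
import Data.List.Relation.Unary.Any as Any
open import Data.List.Relation.Unary.Any.Properties using (lookup-index; map⁺)
open import Data.List.Relation.Unary.Unique.Propositional using (Unique)
import Data.List.Relation.Unary.Unique.Propositional.Properties as Uniqueₚ
import Data.List.Relation.Unary.Unique.Setoid as UniqueSetoid
import Data.List.Relation.Unary.Unique.Setoid.Properties as UniqueSetoidₚ
open import Data.Nat using (ℕ; zero; suc; _+_; _*_; _^_; _≤_; _<_; _≤ᵇ_; _≤?_)
open import Data.Nat.Properties
  using ( ≤-refl; ≤-reflexive; ≤-trans; ≤-<-trans; <⇒≤; ≰⇒>; <⇒≱; ≤∧≢⇒<; ≤ᵇ⇒≤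
        ; m≤m+n; m≤n+m; m≤n⇒m⊓n≡m; +-suc; +-monoˡ-≤; *-monoˡ-≤; *-monoʳ-≤; *-mono-≤
        ; *-monoʳ-<; *-cancelˡ-≤; module ≤-Reasoning)
open import Data.Nat.Primality using (Prime; prime?)
open import Data.Nat.Tactic.RingSolver using (solve-∀)
open import Data.Product using (∃-syntax; _×_; _,_)
open import Data.Vec using (Vec; []; _∷_; replicate; zipWith)
import Data.Vec as Vec
open import Data.Vec.Properties using (∷-injective)
open import Function using (_∘_)
open import Level using (Level)
open import Relation.Binary.Bundles using (Setoid)
open import Relation.Binary.PropositionalEquality as ≡ using (_≡_; _≢_; refl; cong; cong₂; subst)
open import Relation.Nullary using (¬_; Dec; yes; no; contradiction)
open import Relation.Nullary.Decidable using (map′; from-no)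

private variable
  a ℓ : Level
  A B C : Set a

≤-by-evaluation : ∀ {m n} {_ : T (m ≤ᵇ n)} → m ≤ n
≤-by-evaluation {m} {n} {m≤ᵇn} = ≤ᵇ⇒≤ m n m≤ᵇn

m+o≡n⇒m≤n : ∀ {m n} o → m + o ≡ n → m ≤ n
m+o≡n⇒m≤n {m} o refl = m≤m+n m o

6p[p+1]+1-mono : ∀ {p q} → p ≤ q → 6 * p * (p + 1) + 1 ≤ 6 * q * (q + 1) + 1
6p[p+1]+1-mono p≤q = +-monoˡ-≤ 1 (*-mono-≤ (*-monoʳ-≤ 6 p≤q) (+-monoˡ-≤ 1 p≤q))

lower-bound : ∀ m q {p} → q * m + 1 < 2 ^ m → 2 ^ m ≤ p * m + 1 → q < p
lower-bound m q qm+1<2^m 2^m≤pm+1 = ≰⇒> λ p≤q →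
  <⇒≱ qm+1<2^m (≤-trans 2^m≤pm+1 (+-monoˡ-≤ 1 (*-monoˡ-≤ m p≤q)))

via-lower-bound : ∀ m q {p} → q * m + 1 < 2 ^ m → 3 ^ m ≤ 6 * suc q * (suc q + 1) + 1 →
                  2 ^ m ≤ p * m + 1 → 3 ^ m ≤ 6 * p * (p + 1) + 1
via-lower-bound m q {p} qm+1<2^m 3^m≤ 2^m≤pm+1 =
  ≤-trans 3^m≤ (6p[p+1]+1-mono (lower-bound m q {p} qm+1<2^m 2^m≤pm+1))

square-growth : ∀ t → (10 + t) * (10 + t) * 3 ^ (10 + t) ≤ 6 * (2 ^ (10 + t) * 2 ^ (10 + t))
square-growth zero = ≤-by-evaluation
square-growth (suc t) = begin
  suc n * suc n * (3 * 3 ^ n)   ≡⟨ regroup₁ (suc n * suc n) (3 ^ n) ⟩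
  3 * (suc n * suc n) * 3 ^ n   ≤⟨ *-monoˡ-≤ (3 ^ n) (step t) ⟩
  4 * (n * n) * 3 ^ n           ≡⟨ regroup₂ (n * n) (3 ^ n) ⟩
  4 * (n * n * 3 ^ n)           ≤⟨ *-monoʳ-≤ 4 (square-growth t) ⟩
  4 * (6 * (2 ^ n * 2 ^ n))     ≡⟨ regroup₃ (2 ^ n) ⟩
  6 * (2 * 2 ^ n * (2 * 2 ^ n)) ∎
  where
    open ≤-Reasoning
    n : ℕ
    n = 10 + t
    step : ∀ t → 3 * ((11 + t) * (11 + t)) ≤ 4 * ((10 + t) * (10 + t))
    step t = m+o≡n⇒m≤n (t * t + 14 * t + 37) (expand t)
      where
        expand : ∀ t → 3 * ((11 + t) * (11 + t)) + (t * t + 14 * t + 37) ≡ 4 * ((10 + t) * (10 + t))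
        expand = solve-∀
    regroup₁ : ∀ a x → a * (3 * x) ≡ 3 * a * x
    regroup₁ = solve-∀
    regroup₂ : ∀ a x → 4 * a * x ≡ 4 * (a * x)
    regroup₂ = solve-∀
    regroup₃ : ∀ x → 4 * (6 * (x * x)) ≡ 6 * (2 * x * (2 * x))
    regroup₃ = solve-∀

square-bound : ∀ p t →
  6 * ((p * (10 + t) + 1) * (p * (10 + t) + 1)) ≤ (10 + t) * (10 + t) * (6 * p * (p + 1) + 1)
square-bound p t = m+o≡n⇒m≤n (6 * p * (10 + t) * (8 + t) + (t * t + 20 * t + 94)) (expand p t)
  where
    expand : ∀ p t → 6 * ((p * (10 + t) + 1) * (p * (10 + t) + 1))
                       + (6 * p * (10 + t) * (8 + t) + (t * t + 20 * t + 94))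
                   ≡ (10 + t) * (10 + t) * (6 * p * (p + 1) + 1)
    expand = solve-∀

large-exponent : ∀ p t → 2 ^ (10 + t) ≤ p * (10 + t) + 1 → 3 ^ (10 + t) ≤ 6 * p * (p + 1) + 1
large-exponent p t 2^m≤pm+1 = *-cancelˡ-≤ (m * m) (begin
  m * m * 3 ^ m                   ≤⟨ square-growth t ⟩
  6 * (2 ^ m * 2 ^ m)             ≤⟨ *-monoʳ-≤ 6 (*-mono-≤ 2^m≤pm+1 2^m≤pm+1) ⟩
  6 * ((p * m + 1) * (p * m + 1)) ≤⟨ square-bound p t ⟩
  m * m * (6 * p * (p + 1) + 1)   ∎)
  where
    open ≤-Reasoning
    m : ℕ
    m = 10 + t

-- For m < 10, q is the largest number with q m + 1 < 2^m, so the hypothesis forces p > q.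
2^m≤pm+1⇒3^m≤6p[p+1]+1 : ∀ p m → p ≢ 32 → 2 ^ m ≤ p * m + 1 → 3 ^ m ≤ 6 * p * (p + 1) + 1
2^m≤pm+1⇒3^m≤6p[p+1]+1 p 0 _ _ = m≤n+m 1 (6 * p * (p + 1))
2^m≤pm+1⇒3^m≤6p[p+1]+1 p 1 _ = via-lower-bound 1 0 {p} ≤-by-evaluation ≤-by-evaluation
2^m≤pm+1⇒3^m≤6p[p+1]+1 p 2 _ = via-lower-bound 2 1 {p} ≤-by-evaluation ≤-by-evaluation
2^m≤pm+1⇒3^m≤6p[p+1]+1 p 3 _ = via-lower-bound 3 2 {p} ≤-by-evaluation ≤-by-evaluation
2^m≤pm+1⇒3^m≤6p[p+1]+1 p 4 _ = via-lower-bound 4 3 {p} ≤-by-evaluation ≤-by-evaluation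
2^m≤pm+1⇒3^m≤6p[p+1]+1 p 5 _ = via-lower-bound 5 6 {p} ≤-by-evaluation ≤-by-evaluation
2^m≤pm+1⇒3^m≤6p[p+1]+1 p 6 _ = via-lower-bound 6 10 {p} ≤-by-evaluation ≤-by-evaluation
2^m≤pm+1⇒3^m≤6p[p+1]+1 p 7 _ = via-lower-bound 7 18 {p} ≤-by-evaluation ≤-by-evaluation
-- This is where p ≠ 32 is needed: 2^8 ≤ 32 · 8 + 1 but 3^8 > 6 · 32 · 33 + 1.
2^m≤pm+1⇒3^m≤6p[p+1]+1 p 8 p≢32 2^8≤8p+1 = ≤-trans ≤-by-evaluation
  (6p[p+1]+1-mono (≤∧≢⇒< (lower-bound 8 31 {p} ≤-by-evaluation 2^8≤8p+1) (p≢32 ∘ ≡.sym)))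
2^m≤pm+1⇒3^m≤6p[p+1]+1 p 9 _ = via-lower-bound 9 56 {p} ≤-by-evaluation ≤-by-evaluation
2^m≤pm+1⇒3^m≤6p[p+1]+1 p (suc (suc (suc (suc (suc (suc (suc (suc (suc (suc t)))))))))) _ =
  large-exponent p t

6p[p+1]+1<3^k⇒pk+2≤2^k : ∀ p k → p ≢ 32 → 6 * p * (p + 1) + 1 < 3 ^ k → p * k + 2 ≤ 2 ^ k
6p[p+1]+1<3^k⇒pk+2≤2^k p k p≢32 bound<3^k = subst (_≤ 2 ^ k) (≡.sym (+-suc (p * k) 1))
  (≰⇒> (<⇒≱ bound<3^k ∘ 2^m≤pm+1⇒3^m≤6p[p+1]+1 p k p≢32))

n*n<3^n : ∀ n → n * n < 3 ^ n
n*n<3^n 0 = ≤-by-evaluation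
n*n<3^n 1 = ≤-by-evaluation
n*n<3^n 2 = ≤-by-evaluation
n*n<3^n (suc (suc (suc t))) = begin-strict
  (3 + t) * (3 + t)       ≤⟨ m+o≡n⇒m≤n (2 * (t * t) + 6 * t + 3) (expand t) ⟩
  3 * ((2 + t) * (2 + t)) <⟨ *-monoʳ-< 3 (n*n<3^n (suc (suc t))) ⟩
  3 * 3 ^ (2 + t)         ∎
  where
    open ≤-Reasoning
    expand : ∀ t → (3 + t) * (3 + t) + (2 * (t * t) + 6 * t + 3) ≡ 3 * ((2 + t) * (2 + t))
    expand = solve-∀

6p[p+1]+1<3^[6p+1] : ∀ p → 6 * p * (p + 1) + 1 < 3 ^ (6 * p + 1)
6p[p+1]+1<3^[6p+1] p = ≤-<-trans bound≤square (n*n<3^n (6 * p + 1))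
  where
    bound≤square : 6 * p * (p + 1) + 1 ≤ (6 * p + 1) * (6 * p + 1)
    bound≤square = m+o≡n⇒m≤n (30 * (p * p) + 6 * p) (expand p)
      where
        expand : ∀ p → 6 * p * (p + 1) + 1 + (30 * (p * p) + 6 * p) ≡ (6 * p + 1) * (6 * p + 1)
        expand = solve-∀

∃-sublist-with-p|ys|+2≤2^|ys| : ∀ p (xs : List A) → p ≢ 32 → 6 * p * (p + 1) + 1 < 3 ^ length xs →
  ∃[ ys ] (ys ⊆ xs × length ys ≤ 6 * p + 1 × p * length ys + 2 ≤ 2 ^ length ys)
∃-sublist-with-p|ys|+2≤2^|ys| p xs p≢32 bound<3^|xs| with length xs ≤? 6 * p + 1
... | yes |xs|≤6p+1 =
  xs , ⊆-refl , |xs|≤6p+1 , 6p[p+1]+1<3^k⇒pk+2≤2^k p (length xs) p≢32 bound<3^|xs|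
... | no |xs|≰6p+1 = take k xs , take-⊆ k xs ,
  subst (λ n → n ≤ k × p * n + 2 ≤ 2 ^ n) (≡.sym |take|≡k)
        (≤-refl , 6p[p+1]+1<3^k⇒pk+2≤2^k p k p≢32 (6p[p+1]+1<3^[6p+1] p))
  where
    k : ℕ
    k = 6 * p + 1
    |take|≡k : length (take k xs) ≡ k
    |take|≡k = ≡.trans (length-take k xs) (m≤n⇒m⊓n≡m (<⇒≤ (≰⇒> |xs|≰6p+1)))

length-cartesianProductWith : ∀ (f : A → B → C) xs ys →
  length (cartesianProductWith f xs ys) ≡ length xs * length ys
length-cartesianProductWith f [] ys = refl
length-cartesianProductWith f (x ∷ xs) ys = ≡.trans (length-++ (map (f x) ys))
  (cong₂ _+_ (length-map (f x) ys) (length-cartesianProductWith f xs ys))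

vectorsOver : List A → (n : ℕ) → List (Vec A n)
vectorsOver xs zero = [] ∷ []
vectorsOver xs (suc n) = cartesianProductWith _∷_ xs (vectorsOver xs n)

length-vectorsOver : ∀ (xs : List A) n → length (vectorsOver xs n) ≡ length xs ^ n
length-vectorsOver xs zero = refl
length-vectorsOver xs (suc n) = ≡.trans (length-cartesianProductWith _∷_ xs (vectorsOver xs n))
  (cong (length xs *_) (length-vectorsOver xs n))

∈-vectorsOver : ∀ {xs : List A} → (∀ x → x ∈ xs) → ∀ {n} (v : Vec A n) → v ∈ vectorsOver xs n
∈-vectorsOver xs-complete [] = here refl
∈-vectorsOver xs-complete (x ∷ v) =
  ∈-cartesianProductWith⁺ _∷_ (xs-complete x) (∈-vectorsOver xs-complete v)

vectorsOver-unique : ∀ {xs : List A} → Unique xs → ∀ n → Unique (vectorsOver xs n)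
vectorsOver-unique xs! zero = [] ∷ []
vectorsOver-unique xs! (suc n) =
  Uniqueₚ.cartesianProductWith⁺ _∷_ ∷-injective xs! (vectorsOver-unique xs! n)

module _ (S : Setoid a ℓ) where
  open Setoid S using (_≈_) renaming (sym to ≈-sym; trans to ≈-trans; reflexive to ≈-reflexive)
  open SetoidMembership S using () renaming (_∈_ to _∈ₛ_)
  open UniqueSetoid S using () renaming (Unique to Uniqueₛ)

  lookup-injective : ∀ {xs} → Uniqueₛ xs → ∀ i j → lookup xs i ≈ lookup xs j → i ≡ j
  lookup-injective (_ ∷ _) zero zero _ = refl
  lookup-injective (x≉ ∷ _) zero (suc j) x≈ = ⊥-elim (All.lookup x≉ (∈ₚ.∈-lookup j) x≈)
  lookup-injective (x≉ ∷ _) (suc i) zero ≈x = ⊥-elim (All.lookup x≉ (∈ₚ.∈-lookup i) (≈-sym ≈x))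
  lookup-injective (_ ∷ xs!) (suc i) (suc j) eq = cong suc (lookup-injective xs! i j eq)

  unique-⊆⇒length≤ : ∀ {xs ys} → Uniqueₛ xs → (∀ {x} → x ∈ₛ xs → x ∈ₛ ys) → length xs ≤ length ys
  unique-⊆⇒length≤ {xs} {ys} xs! xs⊆ys = injective⇒≤ {f = position} position-injective
    where
      position : Fin (length xs) → Fin (length ys)
      position i = Any.index (xs⊆ys (SetoidMembershipₚ.∈-lookup S xs i))
      position-injective : ∀ {i j} → position i ≡ position j → i ≡ j
      position-injective {i} {j} eq = lookup-injective xs! i j (≈-trans
        (lookup-index (xs⊆ys (SetoidMembershipₚ.∈-lookup S xs i)))
        (≈-trans (≈-reflexive (cong (lookup ys) eq))
                 (≈-sym (lookup-index (xs⊆ys (SetoidMembershipₚ.∈-lookup S xs j))))))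

selection : (xs : List A) → Vec Bool (length xs) → List A
selection [] [] = []
selection (x ∷ xs) (true ∷ u) = x ∷ selection xs u
selection (x ∷ xs) (false ∷ u) = selection xs u

selection-⊆ : ∀ (xs : List A) u → selection xs u ⊆ xs
selection-⊆ [] [] = []
selection-⊆ (x ∷ xs) (true ∷ u) = refl ∷ selection-⊆ xs u
selection-⊆ (x ∷ xs) (false ∷ u) = x ∷ʳ selection-⊆ xs u

selection-none : ∀ (xs : List A) → selection xs (replicate (length xs) false) ≡ []
selection-none [] = refl
selection-none (x ∷ xs) = selection-none xs

indicator : ∀ {ys xs : List A} → ys ⊆ xs → Vec Bool (length xs)
indicator [] = []
indicator (x ∷ʳ σ) = false ∷ indicator σ
indicator (_ ∷ σ) = true ∷ indicator σ

selection-indicator : ∀ {ys xs : List A} (σ : ys ⊆ xs) → selection xs (indicator σ) ≡ ys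
selection-indicator [] = refl
selection-indicator (x ∷ʳ σ) = selection-indicator σ
selection-indicator (refl ∷ σ) = cong (_ ∷_) (selection-indicator σ)

data Coefficient : Set where
  -1ᶜ 0ᶜ 1ᶜ : Coefficient

coefficients : List Coefficient
coefficients = -1ᶜ ∷ 0ᶜ ∷ 1ᶜ ∷ []

∈-coefficients : ∀ c → c ∈ coefficients
∈-coefficients -1ᶜ = here refl
∈-coefficients 0ᶜ = there (here refl)
∈-coefficients 1ᶜ = there (there (here refl))

negate : Coefficient → Coefficient
negate -1ᶜ = 1ᶜ
negate 0ᶜ = 0ᶜ
negate 1ᶜ = -1ᶜ

zeros : ∀ n → Vec Coefficient n
zeros n = replicate n 0ᶜ

_⊖_ : Bool → Bool → Coefficient
true  ⊖ false = 1ᶜ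
false ⊖ true  = -1ᶜ
_     ⊖ _     = 0ᶜ

zipWith-⊖-zeros : ∀ {n} (u v : Vec Bool n) → zipWith _⊖_ u v ≡ zeros n → u ≡ v
zipWith-⊖-zeros [] [] _ = refl
zipWith-⊖-zeros (true ∷ u) (true ∷ v) eq = cong (true ∷_) (zipWith-⊖-zeros u v (cong Vec.tail eq))
zipWith-⊖-zeros (false ∷ u) (false ∷ v) eq = cong (false ∷_) (zipWith-⊖-zeros u v (cong Vec.tail eq))
zipWith-⊖-zeros (true ∷ u) (false ∷ v) ()
zipWith-⊖-zeros (false ∷ u) (true ∷ v) ()

module _ {c ℓ} (G : FiniteAbelianGroup c ℓ) where
  open FiniteAbelianGroup G
    using ( Carrier; _≈_; _∙_; ε; _⁻¹; _≟_; setoid; abGroup; commutativeSemigroup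
          ; ∙-cong; ∙-congˡ; ⁻¹-cong; identityˡ; identityʳ; inverseʳ )
    renaming (refl to ≈-refl; sym to ≈-sym; trans to ≈-trans)
  open import Algebra.Properties.AbelianGroup abGroup
    using (ε⁻¹≈ε; ⁻¹-involutive; ⁻¹-∙-comm; ⁻¹-injective; inverseˡ-unique; x≈y⇒x∙y⁻¹≈ε)
  open SetoidMembership setoid using () renaming (_∈_ to _∈ₛ_)
  open import Relation.Binary.Reasoning.Setoid setoid

  scale : Coefficient → Carrier → Carrier
  scale -1ᶜ x = x ⁻¹
  scale 0ᶜ  x = ε
  scale 1ᶜ  x = x

  signedSum : (xs : List Carrier) → Vec Coefficient (length xs) → Carrier
  signedSum [] [] = ε
  signedSum (x ∷ xs) (c ∷ v) = scale c x ∙ signedSum xs v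

  Dissociated : List Carrier → Set ℓ
  Dissociated xs = ∀ v → signedSum xs v ≈ ε → v ≡ zeros (length xs)

  Spans : List Carrier → Carrier → Set ℓ
  Spans xs x = ∃[ v ] (x ≈ signedSum xs v)

  signedSum-zeros : ∀ xs → signedSum xs (zeros (length xs)) ≈ ε
  signedSum-zeros [] = ≈-refl
  signedSum-zeros (x ∷ xs) = ≈-trans (identityˡ _) (signedSum-zeros xs)

  scale-negate : ∀ c x → scale (negate c) x ≈ scale c x ⁻¹
  scale-negate -1ᶜ x = ≈-sym (⁻¹-involutive x)
  scale-negate 0ᶜ  x = ≈-sym ε⁻¹≈ε
  scale-negate 1ᶜ  x = ≈-refl

  signedSum-negate : ∀ xs v → signedSum xs (Vec.map negate v) ≈ signedSum xs v ⁻¹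
  signedSum-negate [] [] = ≈-sym ε⁻¹≈ε
  signedSum-negate (x ∷ xs) (c ∷ v) =
    ≈-trans (∙-cong (scale-negate c x) (signedSum-negate xs v)) (⁻¹-∙-comm _ _)

  spans-resp-≈ : ∀ {xs x y} → x ≈ y → Spans xs x → Spans xs y
  spans-resp-≈ x≈y (v , x≈Σv) = v , ≈-trans (≈-sym x≈y) x≈Σv

  spans-∷ : ∀ {xs x} y → Spans xs x → Spans (y ∷ xs) x
  spans-∷ y (v , x≈Σv) = 0ᶜ ∷ v , ≈-trans x≈Σv (≈-sym (identityˡ _))

  spans-head : ∀ x xs → Spans (x ∷ xs) x
  spans-head x xs =
    1ᶜ ∷ zeros (length xs) , ≈-sym (≈-trans (∙-congˡ (signedSum-zeros xs)) (identityʳ x))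

  spans? : ∀ xs x → Dec (Spans xs x)
  spans? xs x = map′ satisfied (λ (v , x≈Σv) → lose (∈-vectorsOver ∈-coefficients v) x≈Σv)
                     (any? (λ v → x ≟ signedSum xs v) (vectorsOver coefficients (length xs)))

  ∷-dissociated : ∀ {xs x} → Dissociated xs → ¬ Spans xs x → Dissociated (x ∷ xs)
  ∷-dissociated xs-dis _ (0ᶜ ∷ v) Σ≈ε = cong (0ᶜ ∷_) (xs-dis v (≈-trans (≈-sym (identityˡ _)) Σ≈ε))
  ∷-dissociated {xs} {x} _ x-unspanned (1ᶜ ∷ v) x∙Σv≈ε = contradiction
    (Vec.map negate v , ≈-trans (inverseˡ-unique x _ x∙Σv≈ε) (≈-sym (signedSum-negate xs v)))
    x-unspanned
  ∷-dissociated {xs} {x} _ x-unspanned (-1ᶜ ∷ v) x⁻¹∙Σv≈ε =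
    contradiction (v , ⁻¹-injective (inverseˡ-unique (x ⁻¹) _ x⁻¹∙Σv≈ε)) x-unspanned

  maximal-dissociated : ∀ xs → ∃[ ys ] (ys ⊆ xs × Dissociated ys × All (Spans ys) xs)
  maximal-dissociated [] = [] , [] , (λ { [] _ → refl }) , []
  maximal-dissociated (x ∷ xs) with maximal-dissociated xs
  ... | ys , ys⊆xs , ys-dis , xs-spanned with spans? ys x
  ...   | yes x-spanned = ys , x ∷ʳ ys⊆xs , ys-dis , x-spanned ∷ xs-spanned
  ...   | no x-unspanned = x ∷ ys , refl ∷ ys⊆xs , ∷-dissociated ys-dis x-unspanned ,
                           spans-head x ys ∷ All.map (spans-∷ x) xs-spanned

  signedSums : List Carrier → List Carrier
  signedSums xs = map (signedSum xs) (vectorsOver coefficients (length xs))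

  spans⇒∈-signedSums : ∀ {xs x} → Spans xs x → x ∈ₛ signedSums xs
  spans⇒∈-signedSums (v , x≈Σv) = map⁺ (lose (∈-vectorsOver ∈-coefficients v) x≈Σv)

  length<3^ : ∀ {xs} ys → IsSubset G xs → All (λ x → ¬ x ≈ ε) xs → All (Spans ys) xs →
              length xs < 3 ^ length ys
  length<3^ {xs} ys xs! xs≉ε xs-spanned = ≤-trans
    (unique-⊆⇒length≤ setoid (All.map (λ x≉ε ε≈x → x≉ε (≈-sym ε≈x)) xs≉ε ∷ xs!) covered)
    (≤-reflexive (≡.trans (length-map (signedSum ys) (vectorsOver coefficients (length ys)))
                          (length-vectorsOver coefficients (length ys))))
    where
      covered : ∀ {x} → x ∈ₛ (ε ∷ xs) → x ∈ₛ signedSums ys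
      covered (here x≈ε) =
        spans⇒∈-signedSums {ys} (zeros (length ys) , ≈-trans x≈ε (≈-sym (signedSum-zeros ys)))
      covered (there x∈xs) =
        spans⇒∈-signedSums {ys} (All.lookupₛ setoid (spans-resp-≈ {ys}) xs-spanned x∈xs)

  pad : ∀ {ys xs : List Carrier} → ys ⊆ xs → Vec Coefficient (length ys) → Vec Coefficient (length xs)
  pad [] [] = []
  pad (x ∷ʳ σ) v = 0ᶜ ∷ pad σ v
  pad (_ ∷ σ) (c ∷ v) = c ∷ pad σ v

  signedSum-pad : ∀ {ys xs : List Carrier} (σ : ys ⊆ xs) v → signedSum xs (pad σ v) ≈ signedSum ys v
  signedSum-pad [] [] = ≈-refl
  signedSum-pad (x ∷ʳ σ) v = ≈-trans (identityˡ _) (signedSum-pad σ v)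
  signedSum-pad (refl ∷ σ) (c ∷ v) = ∙-congˡ (signedSum-pad σ v)

  pad-zeros : ∀ {ys xs : List Carrier} (σ : ys ⊆ xs) v → pad σ v ≡ zeros (length xs) → v ≡ zeros (length ys)
  pad-zeros [] [] _ = refl
  pad-zeros (x ∷ʳ σ) v eq = pad-zeros σ v (cong Vec.tail eq)
  pad-zeros (_ ∷ σ) (c ∷ v) eq = cong₂ _∷_ (cong Vec.head eq) (pad-zeros σ v (cong Vec.tail eq))

  dissociated-⊆ : ∀ {ys xs : List Carrier} → ys ⊆ xs → Dissociated xs → Dissociated ys
  dissociated-⊆ σ xs-dis v Σv≈ε = pad-zeros σ v (xs-dis (pad σ v) (≈-trans (signedSum-pad σ v) Σv≈ε))

  subsetSum : (xs : List Carrier) → Vec Bool (length xs) → Carrier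
  subsetSum xs u = sumG G (selection xs u)

  pick : Bool → Carrier → Carrier
  pick true  x = x
  pick false x = ε

  subsetSum-∷ : ∀ x xs b u → subsetSum (x ∷ xs) (b ∷ u) ≈ pick b x ∙ subsetSum xs u
  subsetSum-∷ x xs true  u = ≈-refl
  subsetSum-∷ x xs false u = ≈-sym (identityˡ _)

  scale-⊖ : ∀ a b x → scale (a ⊖ b) x ≈ pick a x ∙ pick b x ⁻¹
  scale-⊖ true  true  x = ≈-sym (inverseʳ x)
  scale-⊖ false false x = ≈-sym (inverseʳ ε)
  scale-⊖ true  false x = ≈-sym (≈-trans (∙-congˡ ε⁻¹≈ε) (identityʳ x))
  scale-⊖ false true  x = ≈-sym (identityˡ _)

  signedSum-⊖ : ∀ xs u v → signedSum xs (zipWith _⊖_ u v) ≈ subsetSum xs u ∙ subsetSum xs v ⁻¹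
  signedSum-⊖ [] [] [] = ≈-sym (inverseʳ ε)
  signedSum-⊖ (x ∷ xs) (a ∷ u) (b ∷ v) = begin
    scale (a ⊖ b) x ∙ signedSum xs (zipWith _⊖_ u v)
      ≈⟨ ∙-cong (scale-⊖ a b x) (signedSum-⊖ xs u v) ⟩
    (pick a x ∙ pick b x ⁻¹) ∙ (subsetSum xs u ∙ subsetSum xs v ⁻¹)
      ≈⟨ interchange commutativeSemigroup _ _ _ _ ⟩
    (pick a x ∙ subsetSum xs u) ∙ (pick b x ⁻¹ ∙ subsetSum xs v ⁻¹)
      ≈⟨ ∙-congˡ (⁻¹-∙-comm _ _) ⟩
    (pick a x ∙ subsetSum xs u) ∙ (pick b x ∙ subsetSum xs v) ⁻¹
      ≈⟨ ∙-cong (≈-sym (subsetSum-∷ x xs a u)) (⁻¹-cong (≈-sym (subsetSum-∷ x xs b v))) ⟩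
    subsetSum (x ∷ xs) (a ∷ u) ∙ subsetSum (x ∷ xs) (b ∷ v) ⁻¹ ∎

  subsetSum-injective : ∀ {xs} → Dissociated xs → ∀ u v → subsetSum xs u ≈ subsetSum xs v → u ≡ v
  subsetSum-injective {xs} xs-dis u v Σu≈Σv =
    zipWith-⊖-zeros u v (xs-dis _ (≈-trans (signedSum-⊖ xs u v) (x≈y⇒x∙y⁻¹≈ε Σu≈Σv)))

  dissociated⇒zeroSumFree : ∀ {xs} → Dissociated xs → ZeroSumFree G xs
  dissociated⇒zeroSumFree {xs} xs-dis ys σ ys-nonempty Σys≈ε =
    subst (NonEmpty G) ys≡[] ys-nonempty
    where
      none : Vec Bool (length xs)
      none = replicate (length xs) false
      indicator≡none : indicator σ ≡ none
      indicator≡none = subsetSum-injective {xs} xs-dis (indicator σ) none (begin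
        subsetSum xs (indicator σ) ≡⟨ cong (sumG G) (selection-indicator σ) ⟩
        sumG G ys                  ≈⟨ Σys≈ε ⟩
        ε                          ≡⟨ cong (sumG G) (selection-none xs) ⟨
        subsetSum xs none          ∎)
      ys≡[] : ys ≡ []
      ys≡[] = ≡.trans (≡.sym (selection-indicator σ))
                      (≡.trans (cong (selection xs) indicator≡none) (selection-none xs))

  dissociated⇒Σ₀-card : ∀ {xs} → Dissociated xs → Σ₀-card-≥ G xs (2 ^ length xs)
  dissociated⇒Σ₀-card {xs} xs-dis =
    map (subsetSum xs) subsets ,
    UniqueSetoidₚ.map⁺ (≡.setoid _) setoid (subsetSum-injective {xs} xs-dis _ _)
                       (vectorsOver-unique booleans-unique (length xs)) ,
    Allₚ.map⁺ (All.tabulate (λ {u} _ → selection xs u , selection-⊆ xs u , ≈-refl)) ,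
    ≤-reflexive (≡.sym (≡.trans (length-map (subsetSum xs) subsets)
                                (length-vectorsOver booleans (length xs))))
    where
      booleans : List Bool
      booleans = false ∷ true ∷ []
      booleans-unique : Unique booleans
      booleans-unique = ((λ ()) ∷ []) ∷ [] ∷ []
      subsets : List (Vec Bool (length xs))
      subsets = vectorsOver booleans (length xs)

  Σ₀-card-≥-mono : ∀ {xs m n} → m ≤ n → Σ₀-card-≥ G xs n → Σ₀-card-≥ G xs m
  Σ₀-card-≥-mono m≤n (sums , sums! , sums∈Σ₀ , n≤|sums|) = sums , sums! , sums∈Σ₀ , ≤-trans m≤n n≤|sums|

prime⇒≢32 : ∀ {p} → Prime p → p ≢ 32
prime⇒≢32 p-prime refl = from-no (prime? 32) p-prime

lemma3p1 : ∀ {c ℓ} (G : FiniteAbelianGroup c ℓ) (p : ℕ) →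
    SmallestPrimeDivisor G p →
    (A : List (FiniteAbelianGroup.Carrier G)) →
    IsSubset G A →
    All (λ a → ¬ (FiniteAbelianGroup._≈_ G a (FiniteAbelianGroup.ε G))) A →
    6 * p * (p + 1) + 1 ≤ length A →
    ∃[ B ] (B ⊆ A × ZeroSumFree G B × length B ≤ 6 * p + 1
            × Σ₀-card-≥ G B (p * length B + 2))
lemma3p1 G p (p-prime , _) A A! A≉0 6p[p+1]+1≤|A|
  with D , D⊆A , D-dissociated , A-spanned ← maximal-dissociated G A
  with B , B⊆D , |B|≤6p+1 , p|B|+2≤2^|B| ← ∃-sublist-with-p|ys|+2≤2^|ys| p D (prime⇒≢32 p-prime)
         (≤-<-trans 6p[p+1]+1≤|A| (length<3^ G D A! A≉0 A-spanned))
  = B , ⊆-trans B⊆D D⊆A , dissociated⇒zeroSumFree G B-dissociated , |B|≤6p+1 ,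
    Σ₀-card-≥-mono G p|B|+2≤2^|B| (dissociated⇒Σ₀-card G B-dissociated)
  where
    B-dissociated : Dissociated G B
    B-dissociated = dissociated-⊆ G B⊆D D-dissociated
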